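{- Let $G=(V,E)$ be a connected simple undirected graph whose edge set carries a fixed total order $<$, and let $F$ be a connected bipartite edge set of $G$. Then $$\mathcal{S}_{\mathrm{sub}}(G,F)=\{F\}\cup\bigsqcup_{e\in N_E(G,F)}\mathcal{S}_{\mathrm{sub}}(G(F,\ge e),\,F\cup\{e\}),$$ where $\bigsqcup$ denotes a disjoint union.
   Context: For an edge set $F$ of a graph $H$, $V[F]$ is the set of endpoints of edges of $F$. A connected bipartite edge set of $H$ is a nonempty edge set $F$ such that $(V[F],F)$ is connected and bipartite (no odd cycle). $\mathcal{S}_{\mathrm{sub}}(H,F)$ is the collection of connected bipartite edge sets $F'$ of $H$ with $F\subseteq F'$. Two edges are adjacent if they share an endpoint. For an edge $e$, $N_E(G,e)$ is the set of edges of $G$ other than $e$ adjacent to $e$, and $N_E(G,F)=\big(\bigcup_{e\in F}N_E(G,e)\big)\setminus F$. For $e\in N_E(G,F)$, $G(F,\ge e)$ is the graph obtained from $G$ by deleting the edges $\{f\in N_E(G,F): f<e\}$. -}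

module Defs where

open import Level using (0ℓ)
open import Data.Nat using (ℕ)
open import Data.Fin using (Fin)
open import Data.Fin.Subset using (Subset; _∈_; _∉_; _⊆_; Nonempty) public
open import Data.Product using (Σ; ∃; _×_)
open import Data.Sum using (_⊎_)
open import Data.Bool using (Bool)
open import Data.Unit using (⊤)
open import Relation.Nullary using (¬_)
open import Relation.Binary.PropositionalEquality using (_≡_; _≢_)
open import Relation.Binary.Structures using (IsStrictTotalOrder)

record Graph : Set₁ where
  field
    n m      : ℕ
    src tgt  : Fin m → Fin n
    loopless : ∀ e → src e ≢ tgt e
    noParallel : ∀ e f →
      ((src e ≡ src f × tgt e ≡ tgt f) ⊎ (src e ≡ tgt f × tgt e ≡ src f)) →
      e ≡ f
    _<ₑ_     : Fin m → Fin m → Set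
    <ₑ-isSTO : IsStrictTotalOrder _≡_ _<ₑ_

module _ (G : Graph) where
  open Graph G

  EdgeSet : Set
  EdgeSet = Subset m

  Incident : Fin m → Fin n → Set
  Incident e v = src e ≡ v ⊎ tgt e ≡ v

  Adjacent : Fin m → Fin m → Set
  Adjacent e f = Incident f (src e) ⊎ Incident f (tgt e)

  InV : EdgeSet → Fin n → Set
  InV F v = ∃ λ e → e ∈ F × Incident e v

  data Walk (P : Fin m → Set) : Fin n → Fin n → Set where
    [] : ∀ {u} → Walk P u u
    step : ∀ {u w v} (e : Fin m) → P e →
           ((src e ≡ u × tgt e ≡ w) ⊎ (tgt e ≡ u × src e ≡ w)) →
           Walk P w v → Walk P u v

  ConnectedGraph : Set
  ConnectedGraph = ∀ u v → Walk (λ _ → ⊤) u v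

  ConnectedES : EdgeSet → Set
  ConnectedES F = ∀ u v → InV F u → InV F v → Walk (λ e → e ∈ F) u v

  BipartiteES : EdgeSet → Set
  BipartiteES F = ∃ λ (c : Fin n → Bool) → ∀ e → e ∈ F → c (src e) ≢ c (tgt e)

  CBES : EdgeSet → Set
  CBES F = Nonempty F × ConnectedES F × BipartiteES F

  -- a subgraph H of G is given by the predicate "edge of G kept in H";
  -- F' ∈ S_sub(H, F)
  InSsub : (Fin m → Set) → EdgeSet → EdgeSet → Set
  InSsub H F F' = (∀ e → e ∈ F' → H e) × CBES F' × F ⊆ F'

  AllEdges : Fin m → Set
  AllEdges _ = ⊤

  InNE : EdgeSet → Fin m → Set
  InNE F f = f ∉ F × ∃ λ e → e ∈ F × f ≢ e × Adjacent e f

  DelBelow : EdgeSet → Fin m → (Fin m → Set)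
  DelBelow F e f = ¬ (InNE F f × f <ₑ e)

module Submission where

-- Let F' be a connected bipartite edge set containing F.
-- Either F' = F, or F' contains an edge f outside F; walking inside F'
-- from V[F] to an endpoint of f, the first edge that leaves F is adjacent
-- to F, so F' meets the edge neighbourhood N_E(G,F).  Taking the least
-- such edge e (the edge order is total and the edge set finite), F' avoids
-- every neighbourhood edge below e, contains F ∪ {e}, hence lies in the
-- piece S_sub(G(F,≥e), F ∪ {e}).  Conversely every piece sits inside
-- S_sub(G,F).  Disjointness: the pieces contain e ∉ F, so none contains F;
-- and if F' lay in the pieces of e < e', then e ∈ F' would be a
-- neighbourhood edge below e' that G(F,≥e') has deleted.

open import Defs
open import Data.Fin.Subset using (_∪_; ⁅_⁆)
open import Data.Product using (∃; _×_)
open import Data.Sum using (_⊎_)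
open import Relation.Nullary using (¬_)
open import Relation.Binary.PropositionalEquality using (_≡_; _≢_)
open import Function.Bundles using (_⇔_)

open import Data.Fin using (Fin)
open import Data.Fin.Properties using (any?) renaming (_≟_ to _≟ᶠ_)
open import Data.Fin.Subset.Properties
  using (_∈?_; x∈⁅x⁆; x∈⁅y⁆⇒x≡y; ⊆-antisym; p⊆p∪q; q⊆p∪q; x∈p∪q⁻)
open import Data.Product using (_,_; proj₁)
open import Data.Sum using (inj₁; inj₂)
open import Data.List using (List; _∷_; allFin)
open import Data.List.Relation.Unary.Any using (Any; here; there)
import Data.List.Relation.Unary.Any as Any
open import Data.List.Membership.Propositional using () renaming (_∈_ to _∈ₗ_)
open import Data.List.Membership.Propositional.Properties using (∈-allFin)
open import Data.Unit using (tt)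
open import Relation.Nullary using (Dec; yes; no; contradiction)
open import Relation.Nullary.Decidable using (_×-dec_; _⊎-dec_; ¬?)
open import Relation.Unary using (Pred; Decidable)
open import Relation.Binary.Core using (Rel)
open import Relation.Binary.PropositionalEquality using (refl; sym; subst)
open import Relation.Binary.Definitions using (tri<; tri≈; tri>)
open import Relation.Binary.Structures using (IsStrictTotalOrder)
open import Function.Bundles using (mk⇔)

module LeastElement {a ℓ p} {A : Set a} {_<_ : Rel A ℓ}
                    (sto : IsStrictTotalOrder _≡_ _<_)
                    {P : Pred A p} (P? : Decidable P) where
  open IsStrictTotalOrder sto using (compare; irrefl; trans)

  LeastIn : List A → A → Set _
  LeastIn xs c = P c × (∀ y → y ∈ₗ xs → P y → ¬ (y < c))

  leastIn : ∀ xs → Any P xs → ∃ (LeastIn xs)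
  leastIn (x ∷ xs) any-x∷xs with Any.any? P? xs
  ... | no none with any-x∷xs
  ...   | here px  = x , px , onlyX
    where
      onlyX : ∀ y → y ∈ₗ x ∷ xs → P y → ¬ (y < x)
      onlyX y (here refl) _ = irrefl refl
      onlyX y (there y∈) py _ = none (Any.map (λ { refl → py }) y∈)
  ...   | there ps = contradiction ps none
  leastIn (x ∷ xs) _ | yes ps with leastIn xs ps | P? x
  ... | c , pc , least | no ¬px = c , pc , λ
    { y (here refl) py → contradiction py ¬px
    ; y (there y∈) py → least y y∈ py }
  ... | c , pc , least | yes px with compare x c
  ...   | tri< x<c _ _ = x , px , λ
    { y (here refl) _  → irrefl refl
    ; y (there y∈) py y<x → least y y∈ py (trans y<x x<c) }
  ...   | tri≈ x≮c _ _ = c , pc , λ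
    { y (here refl) _  → x≮c
    ; y (there y∈) py → least y y∈ py }
  ...   | tri> x≮c _ _ = c , pc , λ
    { y (here refl) _  → x≮c
    ; y (there y∈) py → least y y∈ py }

  least : (xs : List A) → (∀ y → y ∈ₗ xs) → ∀ {x} → P x →
          ∃ λ c → P c × (∀ y → P y → ¬ (y < c))
  least xs enum {x} px with leastIn xs (Any.map (λ { refl → px }) (enum x))
  ... | c , pc , minimal = c , pc , λ y → minimal y (enum y)

module _ (G : Graph) where
  open Graph G

  incident⇒adjacent : ∀ {e f v} → Incident G e v → Incident G f v → Adjacent G e f
  incident⇒adjacent (inj₁ refl) f∋v = inj₁ f∋v
  incident⇒adjacent (inj₂ refl) f∋v = inj₂ f∋v

  incident? : ∀ e v → Dec (Incident G e v)
  incident? e v = (src e ≟ᶠ v) ⊎-dec (tgt e ≟ᶠ v)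

  adjacent? : ∀ e f → Dec (Adjacent G e f)
  adjacent? e f = incident? f (src e) ⊎-dec incident? f (tgt e)

  inNE? : ∀ F f → Dec (InNE G F f)
  inNE? F f = ¬? (f ∈? F)
    ×-dec any? (λ e → (e ∈? F) ×-dec (¬? (f ≟ᶠ e) ×-dec adjacent? e f))

  boundaryEdge : ∀ {F e f v} → e ∈ F → Incident G e v → f ∉ F → Incident G f v →
                 InNE G F f
  boundaryEdge e∈F e∋v f∉F f∋v =
    f∉F , _ , e∈F , (λ { refl → f∉F e∈F }) , incident⇒adjacent e∋v f∋v

  -- Boundary lemma: a walk in F' from V[F] to an endpoint of an edge of
  -- F' ∖ F crosses an edge of F' lying in N_E(G,F), namely the first edge
  -- of the walk (or f itself) outside F.
  leavesF : ∀ {F F' u v f} → Walk G (_∈ F') u v → InV G F u →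
            f ∈ F' → f ∉ F → Incident G f v → ∃ λ h → h ∈ F' × InNE G F h
  leavesF [] (e , e∈F , e∋u) f∈F' f∉F f∋u =
    _ , f∈F' , boundaryEdge e∈F e∋u f∉F f∋u
  leavesF {F} (step e e∈F' dir walk) (g , g∈F , g∋u) f∈F' f∉F f∋v with e ∈? F
  ... | yes e∈F = leavesF walk (e , e∈F , endIncident dir) f∈F' f∉F f∋v
    where
      endIncident : ∀ {u w} → (src e ≡ u × tgt e ≡ w) ⊎ (tgt e ≡ u × src e ≡ w) →
                    Incident G e w
      endIncident (inj₁ (_ , t≡w)) = inj₂ t≡w
      endIncident (inj₂ (_ , s≡w)) = inj₁ s≡w
  ... | no e∉F = e , e∈F' , boundaryEdge g∈F g∋u e∉F (startIncident dir)
    where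
      startIncident : ∀ {u w} → (src e ≡ u × tgt e ≡ w) ⊎ (tgt e ≡ u × src e ≡ w) →
                      Incident G e u
      startIncident (inj₁ (s≡u , _)) = inj₁ s≡u
      startIncident (inj₂ (t≡u , _)) = inj₂ t≡u

  open IsStrictTotalOrder <ₑ-isSTO using (compare)

  Piece : EdgeSet G → Fin m → EdgeSet G → Set
  Piece F e = InSsub G (DelBelow G F e) (F ∪ ⁅ e ⁆)

  piece∋e : ∀ {F e F'} → Piece F e F' → e ∈ F'
  piece∋e {F} {e} (_ , _ , F∪e⊆F') = F∪e⊆F' (q⊆p∪q F ⁅ e ⁆ (x∈⁅x⁆ e))

  piece⊆Ssub : ∀ {F e F'} → Piece F e F' → InSsub G (AllEdges G) F F'
  piece⊆Ssub {F} {e} (_ , cbes , F∪e⊆F') =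
    (λ _ _ → tt) , cbes , λ x∈F → F∪e⊆F' (p⊆p∪q ⁅ e ⁆ x∈F)

  least⇒piece : ∀ {F e F'} → InSsub G (AllEdges G) F F' → e ∈ F' →
                (∀ f → f ∈ F' → InNE G F f → ¬ (f <ₑ e)) → Piece F e F'
  least⇒piece {F} {e} {F'} (_ , cbes , F⊆F') e∈F' minimal =
    (λ f f∈F' (f∈NE , f<e) → minimal f f∈F' f∈NE f<e) , cbes , F∪e⊆F'
    where
      F∪e⊆F' : F ∪ ⁅ e ⁆ ⊆ F'
      F∪e⊆F' {x} x∈ with x∈p∪q⁻ F ⁅ e ⁆ x∈
      ... | inj₁ x∈F = F⊆F' x∈F
      ... | inj₂ x∈e = subst (_∈ F') (sym (x∈⁅y⁆⇒x≡y e x∈e)) e∈F'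

  equalOrNewEdge : ∀ {F F' : EdgeSet G} → F ⊆ F' → F' ≡ F ⊎ ∃ λ f → f ∈ F' × f ∉ F
  equalOrNewEdge {F} {F'} F⊆F' with any? (λ f → (f ∈? F') ×-dec ¬? (f ∈? F))
  ... | yes new = inj₂ new
  ... | no none = inj₁ (⊆-antisym F'⊆F F⊆F')
    where
      F'⊆F : F' ⊆ F
      F'⊆F {x} x∈F' with x ∈? F
      ... | yes x∈F = x∈F
      ... | no x∉F = contradiction (x , x∈F' , x∉F) none

  extensionMeetsNE : ∀ {F F' f} → Nonempty F → ConnectedES G F' → F ⊆ F' →
                     f ∈ F' → f ∉ F → ∃ λ h → h ∈ F' × InNE G F h
  extensionMeetsNE {f = f} (e , e∈F) connected F⊆F' f∈F' f∉F =
    leavesF (connected (src e) (src f) (e , F⊆F' e∈F , inj₁ refl) (f , f∈F' , inj₁ refl))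
            (e , e∈F , inj₁ refl) f∈F' f∉F (inj₁ refl)

  meetsNE⇒piece : ∀ {F F'} → InSsub G (AllEdges G) F F' →
                  ∃ (λ h → h ∈ F' × InNE G F h) → ∃ λ e → InNE G F e × Piece F e F'
  meetsNE⇒piece {F} {F'} inSsub (h , h∈F'∩NE) =
    let e , (e∈F' , e∈NE) , minimal =
          LeastElement.least <ₑ-isSTO (λ x → (x ∈? F') ×-dec inNE? F x)
                             (allFin m) ∈-allFin h∈F'∩NE
    in e , e∈NE , least⇒piece inSsub e∈F' (λ f f∈F' f∈NE → minimal f (f∈F' , f∈NE))

  decompose : ∀ {F F'} → CBES G F → InSsub G (AllEdges G) F F' →
              F' ≡ F ⊎ ∃ λ e → InNE G F e × Piece F e F'
  decompose (nonempty , _) inSsub@(_ , (_ , connected , _) , F⊆F')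
    with equalOrNewEdge F⊆F'
  ... | inj₁ F'≡F = inj₁ F'≡F
  ... | inj₂ (f , f∈F' , f∉F) =
    inj₂ (meetsNE⇒piece inSsub (extensionMeetsNE nonempty connected F⊆F' f∈F' f∉F))

  F∉piece : ∀ {F e} → InNE G F e → ¬ Piece F e F
  F∉piece (e∉F , _) inPiece = e∉F (piece∋e inPiece)

  -- distinct pieces are disjoint: for e < e', the piece of e' has deleted e
  piecesDisjoint : ∀ {F e e' F'} → InNE G F e → InNE G F e' → e ≢ e' →
                   Piece F e F' → ¬ Piece F e' F'
  piecesDisjoint {e = e} {e'} e∈NE e'∈NE e≢e' inPiece inPiece' with compare e e'
  ... | tri< e<e' _ _ = proj₁ inPiece' e (piece∋e inPiece) (e∈NE , e<e')
  ... | tri≈ _ e≡e' _ = e≢e' e≡e'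
  ... | tri> _ _ e'<e = proj₁ inPiece e' (piece∋e inPiece') (e'∈NE , e'<e)

lemma9 : (G : Graph) → ConnectedGraph G →
    (F : EdgeSet G) → CBES G F →
    -- set equality S_sub(G,F) = {F} ∪ ⋃_{e ∈ N_E(G,F)} S_sub(G(F,≥e), F ∪ {e})
    (∀ (F' : EdgeSet G) →
       InSsub G (AllEdges G) F F' ⇔
       (F' ≡ F ⊎ ∃ λ e → InNE G F e × InSsub G (DelBelow G F e) (F ∪ ⁅ e ⁆) F'))
    -- the union is disjoint: {F} is disjoint from each piece
    × (∀ e → InNE G F e → ¬ InSsub G (DelBelow G F e) (F ∪ ⁅ e ⁆) F)
    -- and the pieces for distinct e, e' are pairwise disjoint
    × (∀ e e' (F' : EdgeSet G) → InNE G F e → InNE G F e' → e ≢ e' →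
         InSsub G (DelBelow G F e) (F ∪ ⁅ e ⁆) F' →
         ¬ InSsub G (DelBelow G F e') (F ∪ ⁅ e' ⁆) F')
lemma9 G _ F cbes =
  (λ F' → mk⇔ (decompose G cbes) (reassemble F')) ,
  (λ e → F∉piece G) ,
  (λ e e' F' → piecesDisjoint G)
  where
    reassemble : ∀ F' → F' ≡ F ⊎ ∃ (λ e → InNE G F e × Piece G F e F') →
                 InSsub G (AllEdges G) F F'
    reassemble F' (inj₁ refl)               = (λ _ _ → tt) , cbes , λ x∈F → x∈F
    reassemble F' (inj₂ (_ , _ , inPiece)) = piece⊆Ssub G inPiece
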